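{- Let $G$ be a finite graph and $f:G\to K_k$ a null coloring. Then for any two distinct colors $i,j$ and any cycle $C$ of $G$, the number of edges of $C$ whose endpoints have colors $i$ and $j$ is even.
   Context: A $k$-coloring of a graph $G$ is a surjective map $f:V(G)\to\{1,\dots,k\}$ (not necessarily proper). Regarding graphs as topological spaces (1-dimensional cell complexes), a $k$-coloring is viewed as a continuous map $f:G\to K_k$ (complete graph on vertex set $\{1,\dots,k\}$) sending each vertex to its color and each edge linearly onto the edge between the colors of its endpoints, or constantly to a vertex if both endpoints have the same color. The coloring $f$ is a null coloring if the induced map $f_*:H_1(G)\to H_1(K_k)$ on first integral homology is zero. -}

module Defs where

open import Data.Nat using (ℕ; zero; suc)
open import Data.Fin using (Fin; zero; suc)
open import Data.Fin.Properties using (_≟_)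
open import Data.Integer using (ℤ; _+_; _-_; _*_; 0ℤ; 1ℤ)
open import Data.Bool using (Bool; true; false; if_then_else_)
open import Data.Maybe using (Maybe; just; nothing; fromMaybe)
import Data.Maybe as Maybe
open import Data.Product using (Σ; _×_; _,_)
open import Data.Sum using (_⊎_)
open import Relation.Binary.PropositionalEquality using (_≡_)
open import Relation.Nullary using (¬_)
open import Relation.Nullary.Decidable using (⌊_⌋; _×-dec_; _⊎-dec_)
open import Function.Definitions using (Injective; Surjective)

-- A finite graph, regarded as a 1-dimensional cell complex:
-- vertices Fin nV, edges Fin nE, each edge e with a chosen reference
-- orientation from src e to tgt e.  (Loops and multiple edges allowed.)
record Graph : Set where
  field
    nV  : ℕ
    nE  : ℕ
    src : Fin nE → Fin nV
    tgt : Fin nE → Fin nV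
open Graph public

Σℤ : ∀ {m} → (Fin m → ℤ) → ℤ
Σℤ {zero}  g = 0ℤ
Σℤ {suc m} g = g zero + Σℤ (λ i → g (suc i))

countB : ∀ {m} → (Fin m → Bool) → ℕ
countB {zero}  p = zero
countB {suc m} p = (if p zero then 1 else 0) Data.Nat.+ countB (λ i → p (suc i))

δ : ∀ {n} → Fin n → Fin n → ℤ
δ a b = if ⌊ a ≟ b ⌋ then 1ℤ else 0ℤ

C₁ : Graph → Set
C₁ G = Fin (nE G) → ℤ

∂ : (G : Graph) → C₁ G → Fin (nV G) → ℤ
∂ G z v = Σℤ (λ e → z e * (δ (tgt G e) v - δ (src G e) v))

-- Since G has no 2-cells, H₁(G) = Z₁(G) = ker ∂.
IsCycle₁ : (G : Graph) → C₁ G → Set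
IsCycle₁ G z = ∀ v → ∂ G z v ≡ 0ℤ

record Coloring (G : Graph) (k : ℕ) : Set where
  field
    col  : Fin (nV G) → Fin k
    surj : Surjective _≡_ _≡_ col
open Coloring public

-- K_k: vertices Fin k, one edge for each pair i ≠ j (unordered), with
-- orientation i → j for the representative (i,j).  The coefficient of the
-- chain f_#(z) on the oriented edge (i,j): an edge e of G contributes
-- +z(e) if it goes from colour i to colour j, −z(e) if from j to i,
-- and 0 otherwise (including constant edges).
sgn : ∀ {k} → Fin k → Fin k → Fin k → Fin k → ℤ
sgn a b i j =
  if ⌊ (a ≟ i) ×-dec (b ≟ j) ⌋ then 1ℤ
  else (if ⌊ (a ≟ j) ×-dec (b ≟ i) ⌋ then Data.Integer.-_ 1ℤ else 0ℤ)

push : (G : Graph) {k : ℕ} → Coloring G k → C₁ G → Fin k → Fin k → ℤ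
push G f z i j = Σℤ (λ e → z e * sgn (col f (src G e)) (col f (tgt G e)) i j)

-- Null coloring: f_* : H₁(G) → H₁(K_k) is zero.  As K_k has no 2-cells,
-- H₁(K_k) = Z₁(K_k) ⊆ C₁(K_k), so f_*[z] = 0 iff the chain f_#(z) is zero,
-- i.e. its coefficient on every edge {i,j} (i ≠ j) of K_k vanishes.
NullColoring : (G : Graph) {k : ℕ} → Coloring G k → Set
NullColoring G {k} f =
  (z : C₁ G) → IsCycle₁ G z → (i j : Fin k) → ¬ (i ≡ j) → push G f z i j ≡ 0ℤ

step : ∀ {l} → Fin (suc l) → Maybe (Fin (suc l))
step {zero}  zero    = nothing
step {suc l} zero    = just (suc zero)
step {suc l} (suc i) = Maybe.map suc (step i)

next : ∀ {l} → Fin (suc l) → Fin (suc l)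
next i = fromMaybe zero (step i)

record GCycle (G : Graph) : Set where
  field
    len   : ℕ
    vert  : Fin (suc len) → Fin (nV G)
    edge  : Fin (suc len) → Fin (nE G)
    vinj  : Injective _≡_ _≡_ vert
    einj  : Injective _≡_ _≡_ edge
    joins : ∀ t → (src G (edge t) ≡ vert t × tgt G (edge t) ≡ vert (next t))
                ⊎ (src G (edge t) ≡ vert (next t) × tgt G (edge t) ≡ vert t)
open GCycle public

countColoured : (G : Graph) {k : ℕ} → Coloring G k → GCycle G → Fin k → Fin k → ℕ
countColoured G f C i j = countB (λ t →
  let a = col f (src G (edge C t)) ; b = col f (tgt G (edge C t)) in
  ⌊ ((a ≟ i) ×-dec (b ≟ j)) ⊎-dec ((a ≟ j) ×-dec (b ≟ i)) ⌋)

-- Orienting each edge of C in the direction of travel turns C into a 1-cycle z with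
-- coefficients ±1 on its edges.
-- The coefficient of f_# z on the edge {i,j} of K_k is then a sum of ±1 over the edges of C
-- coloured i and j, which vanishes because f is null; a vanishing sum of ±1's has an even
-- number of terms.
module Submission where

open import Defs
open import Data.Nat using (ℕ)
open import Data.Fin using (Fin)
open import Data.Nat.Divisibility using (_∣_)
open import Relation.Binary.PropositionalEquality using (_≡_)
open import Relation.Nullary using (¬_)

import Data.Nat as ℕ
open import Data.Fin using (zero; suc; inject₁; fromℕ)
open import Data.Fin.Properties using (_≟_)
open import Data.Integer using (ℤ; +_; -[1+_]; _+_; _-_; _*_; -_; ∣_∣; 0ℤ; 1ℤ; -1ℤ)
open import Data.Integer.Properties
  using (+-*-semiring; +-comm; +-identityˡ; +-identityʳ; +-inverseʳ; *-assoc; *-identityˡ; -1*i≡-i; ∣-i∣≡∣i∣; pos-+)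
open import Data.Integer.Divisibility.Signed as Signed using (divides; ∣m∣n⇒∣m+n; ∣⇒∣ᵤ)
open import Data.Integer.Tactic.RingSolver using (solve-∀)
open import Algebra.Properties.Semiring.Sum +-*-semiring
  using (sum; sum-cong-≗; sum-init-last; sum-replicate-zero; ∑-distrib-+; ∑-comm; *-distribˡ-sum; *-distribʳ-sum)
open import Data.Bool using (Bool; if_then_else_)
open import Function using (_∘_)
open import Data.Maybe using (just; nothing; fromMaybe)
import Data.Maybe as Maybe
open import Data.Product using (_×_; _,_)
open import Data.Sum using (_⊎_; inj₁; inj₂; [_,_])
open import Relation.Binary.PropositionalEquality using (refl; sym; trans; cong; cong₂; subst; module ≡-Reasoning)
open import Relation.Nullary using (yes; no)
open import Relation.Nullary.Decidable using (⌊_⌋; _×-dec_; _⊎-dec_)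

Σℤ≡sum : ∀ {m} (g : Fin m → ℤ) → Σℤ g ≡ sum g
Σℤ≡sum {ℕ.zero}  g = refl
Σℤ≡sum {ℕ.suc m} g = cong (_+_ (g zero)) (Σℤ≡sum (λ t → g (suc t)))

δ-suc : ∀ {n} (a b : Fin n) → δ {ℕ.suc n} (suc a) (suc b) ≡ δ a b
δ-suc a b with a ≟ b
... | yes _ = refl
... | no _  = refl

sum-δ : ∀ {n} (a : Fin n) (w : Fin n → ℤ) → sum (λ e → δ a e * w e) ≡ w a
sum-δ {ℕ.suc n} zero w = begin
  1ℤ * w zero + sum {n} (λ e → 0ℤ) ≡⟨ cong (_+_ (1ℤ * w zero)) (sum-replicate-zero n) ⟩
  1ℤ * w zero + 0ℤ                  ≡⟨ +-identityʳ _ ⟩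
  1ℤ * w zero                       ≡⟨ *-identityˡ (w zero) ⟩
  w zero                            ∎
  where open ≡-Reasoning
sum-δ {ℕ.suc n} (suc a) w = begin
  0ℤ + sum (λ e → δ (suc a) (suc e) * w (suc e)) ≡⟨ +-identityˡ _ ⟩
  sum (λ e → δ (suc a) (suc e) * w (suc e))      ≡⟨ sum-cong-≗ (λ e → cong (_* w (suc e)) (δ-suc a e)) ⟩
  sum (λ e → δ a e * w (suc e))                  ≡⟨ sum-δ a (λ e → w (suc e)) ⟩
  w (suc a)                                      ∎
  where open ≡-Reasoning

next-inject₁ : ∀ {l} (t : Fin l) → next (inject₁ t) ≡ suc t
next-inject₁ t = cong (fromMaybe zero) (step-inject₁ t)
  where
  step-inject₁ : ∀ {l} (t : Fin l) → step (inject₁ t) ≡ just (suc t)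
  step-inject₁ {ℕ.suc l} zero    = refl
  step-inject₁ {ℕ.suc l} (suc t) = cong (Maybe.map suc) (step-inject₁ t)

next-fromℕ : ∀ l → next (fromℕ l) ≡ zero
next-fromℕ l = cong (fromMaybe zero) (step-fromℕ l)
  where
  step-fromℕ : ∀ l → step (fromℕ l) ≡ nothing
  step-fromℕ ℕ.zero    = refl
  step-fromℕ (ℕ.suc l) = cong (Maybe.map suc) (step-fromℕ l)

sum-next : ∀ {l} (g : Fin (ℕ.suc l) → ℤ) → sum (λ t → g (next t)) ≡ sum g
sum-next {l} g = begin
  sum (λ t → g (next t))
    ≡⟨ sum-init-last (λ t → g (next t)) ⟩
  sum (λ t → g (next (inject₁ t))) + g (next (fromℕ l))
    ≡⟨ cong₂ _+_ (sum-cong-≗ (cong g ∘ next-inject₁)) (cong g (next-fromℕ l)) ⟩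
  sum (λ t → g (suc t)) + g zero
    ≡⟨ +-comm _ (g zero) ⟩
  sum g
    ∎
  where open ≡-Reasoning

sum-neg : ∀ {m} (g : Fin m → ℤ) → sum (λ t → - g t) ≡ - sum g
sum-neg g = begin
  sum (λ t → - g t)     ≡⟨ sum-cong-≗ (λ t → sym (-1*i≡-i (g t))) ⟩
  sum (λ t → -1ℤ * g t) ≡⟨ sym (*-distribˡ-sum -1ℤ g) ⟩
  -1ℤ * sum g           ≡⟨ -1*i≡-i (sum g) ⟩
  - sum g               ∎
  where open ≡-Reasoning

sum-next-telescopes : ∀ {l} (g : Fin (ℕ.suc l) → ℤ) → sum (λ t → g (next t) - g t) ≡ 0ℤ
sum-next-telescopes g = begin
  sum (λ t → g (next t) - g t)                ≡⟨ ∑-distrib-+ (λ t → g (next t)) (λ t → - g t) ⟩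
  sum (λ t → g (next t)) + sum (λ t → - g t) ≡⟨ cong₂ _+_ (sum-next g) (sum-neg g) ⟩
  sum g - sum g                               ≡⟨ +-inverseʳ (sum g) ⟩
  0ℤ                                          ∎
  where open ≡-Reasoning

module ClosedWalk {G : Graph} {l : ℕ}
  (vert  : Fin (ℕ.suc l) → Fin (nV G))
  (edge  : Fin (ℕ.suc l) → Fin (nE G))
  (joins : ∀ t → (src G (edge t) ≡ vert t × tgt G (edge t) ≡ vert (next t))
               ⊎ (src G (edge t) ≡ vert (next t) × tgt G (edge t) ≡ vert t))
  where

  orientation : Fin (ℕ.suc l) → ℤ
  orientation t = [ (λ _ → 1ℤ) , (λ _ → -1ℤ) ] (joins t)

  ∣orientation*i∣ : ∀ t i → ∣ orientation t * i ∣ ≡ ∣ i ∣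
  ∣orientation*i∣ t i with joins t
  ... | inj₁ _ = cong ∣_∣ (*-identityˡ i)
  ... | inj₂ _ = trans (cong ∣_∣ (-1*i≡-i i)) (∣-i∣≡∣i∣ i)

  walkChain : C₁ G
  walkChain e = sum (λ t → orientation t * δ (edge t) e)

  sum-walkChain-* : (h : Fin (nE G) → ℤ) →
                    sum (λ e → walkChain e * h e) ≡ sum (λ t → orientation t * h (edge t))
  sum-walkChain-* h = begin
    sum (λ e → walkChain e * h e)
      ≡⟨ sum-cong-≗ (λ e → *-distribʳ-sum (h e) (λ t → orientation t * δ (edge t) e)) ⟩
    sum (λ e → sum (λ t → orientation t * δ (edge t) e * h e))
      ≡⟨ ∑-comm (λ e t → orientation t * δ (edge t) e * h e) ⟩
    sum (λ t → sum (λ e → orientation t * δ (edge t) e * h e))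
      ≡⟨ sum-cong-≗ (λ t → sum-cong-≗ (λ e → *-assoc (orientation t) (δ (edge t) e) (h e))) ⟩
    sum (λ t → sum (λ e → orientation t * (δ (edge t) e * h e)))
      ≡⟨ sum-cong-≗ (λ t → sym (*-distribˡ-sum (orientation t) (λ e → δ (edge t) e * h e))) ⟩
    sum (λ t → orientation t * sum (λ e → δ (edge t) e * h e))
      ≡⟨ sum-cong-≗ (λ t → cong (orientation t *_) (sum-δ (edge t) h)) ⟩
    sum (λ t → orientation t * h (edge t))
      ∎
    where open ≡-Reasoning

  orientation-boundary : ∀ v t → orientation t * (δ (tgt G (edge t)) v - δ (src G (edge t)) v)
                                 ≡ δ (vert (next t)) v - δ (vert t) v
  orientation-boundary v t with joins t
  ... | inj₁ (s , e) rewrite s | e = *-identityˡ _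
  ... | inj₂ (s , e) rewrite s | e = neg-difference (δ (vert (next t)) v) (δ (vert t) v)
    where
    neg-difference : ∀ a b → -1ℤ * (b - a) ≡ a - b
    neg-difference = solve-∀

  walkChain-isCycle : IsCycle₁ G walkChain
  walkChain-isCycle v = begin
    ∂ G walkChain v
      ≡⟨ Σℤ≡sum {nE G} _ ⟩
    sum (λ e → walkChain e * (δ (tgt G e) v - δ (src G e) v))
      ≡⟨ sum-walkChain-* (λ e → δ (tgt G e) v - δ (src G e) v) ⟩
    sum (λ t → orientation t * (δ (tgt G (edge t)) v - δ (src G (edge t)) v))
      ≡⟨ sum-cong-≗ (orientation-boundary v) ⟩
    sum (λ t → δ (vert (next t)) v - δ (vert t) v)
      ≡⟨ sum-next-telescopes (λ t → δ (vert t) v) ⟩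
    0ℤ
      ∎
    where open ≡-Reasoning

  push-walkChain : ∀ {k} (f : Coloring G k) (i j : Fin k) →
                   push G f walkChain i j
                   ≡ sum (λ t → orientation t * sgn (col f (src G (edge t))) (col f (tgt G (edge t))) i j)
  push-walkChain f i j =
    trans (Σℤ≡sum {nE G} _) (sum-walkChain-* (λ e → sgn (col f (src G e)) (col f (tgt G e)) i j))

∣sgn∣ : ∀ {k} (a b i j : Fin k) →
        ∣ sgn a b i j ∣ ≡ (if ⌊ ((a ≟ i) ×-dec (b ≟ j)) ⊎-dec ((a ≟ j) ×-dec (b ≟ i)) ⌋ then 1 else 0)
∣sgn∣ a b i j with (a ≟ i) ×-dec (b ≟ j) | (a ≟ j) ×-dec (b ≟ i)
... | yes _ | _     = refl
... | no _  | yes _ = refl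
... | no _  | no _  = refl

∣i∣≡i-mod-2 : ∀ i → + 2 Signed.∣ (+ ∣ i ∣ - i)
∣i∣≡i-mod-2 (+ n)    = divides 0ℤ (+-inverseʳ (+ n))
∣i∣≡i-mod-2 -[1+ n ] = divides (+ ℕ.suc n) (double (+ ℕ.suc n))
  where
  double : ∀ x → x + x ≡ x * + 2
  double = solve-∀

countB≡sum-mod-2 : ∀ {m} (p : Fin m → Bool) (x : Fin m → ℤ) →
                   (∀ t → ∣ x t ∣ ≡ (if p t then 1 else 0)) → + 2 Signed.∣ (+ countB p - sum x)
countB≡sum-mod-2 {ℕ.zero}  p x ∣x∣ = divides 0ℤ refl
countB≡sum-mod-2 {ℕ.suc m} p x ∣x∣ =
  subst (+ 2 Signed.∣_) (sym split) (∣m∣n⇒∣m+n head (countB≡sum-mod-2 (p ∘ suc) (x ∘ suc) (∣x∣ ∘ suc)))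
  where
  head : + 2 Signed.∣ (+ (if p zero then 1 else 0) - x zero)
  head = subst (λ n → + 2 Signed.∣ (+ n - x zero)) (∣x∣ zero) (∣i∣≡i-mod-2 (x zero))
  interchange : ∀ a b c d → (a + b) - (c + d) ≡ (a - c) + (b - d)
  interchange = solve-∀
  split : + countB p - sum x
          ≡ (+ (if p zero then 1 else 0) - x zero) + (+ countB (p ∘ suc) - sum (x ∘ suc))
  split = trans (cong (_- sum x) (pos-+ (if p zero then 1 else 0) (countB (p ∘ suc))))
                (interchange (+ (if p zero then 1 else 0)) (+ countB (p ∘ suc)) (x zero) (sum (x ∘ suc)))

countB-even : ∀ {m} (p : Fin m → Bool) (x : Fin m → ℤ) →
              (∀ t → ∣ x t ∣ ≡ (if p t then 1 else 0)) → sum x ≡ 0ℤ → 2 ∣ countB p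
countB-even p x ∣x∣ sum≡0 = ∣⇒∣ᵤ (subst (+ 2 Signed.∣_) count-0≡count (countB≡sum-mod-2 p x ∣x∣))
  where
  count-0≡count : + countB p - sum x ≡ + countB p
  count-0≡count = trans (cong (λ s → + countB p - s) sum≡0) (+-identityʳ _)

lemma3 : (G : Graph) (k : ℕ) (f : Coloring G k) → NullColoring G f →
         (i j : Fin k) → ¬ (i ≡ j) → (C : GCycle G) →
         2 ∣ countColoured G f C i j
lemma3 G _ f null i j i≢j C =
  countB-even (λ t → coloured-ij (edge C t)) (λ t → orientation t * colourSign (edge C t))
              (λ t → trans (∣orientation*i∣ t _) (∣sgn∣ _ _ i j))
              signedCount≡0
  where
  open ClosedWalk {G} (vert C) (edge C) (joins C)
  coloured-ij : Fin (nE G) → Bool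
  coloured-ij e = let a = col f (src G e) ; b = col f (tgt G e) in
    ⌊ ((a ≟ i) ×-dec (b ≟ j)) ⊎-dec ((a ≟ j) ×-dec (b ≟ i)) ⌋
  colourSign : Fin (nE G) → ℤ
  colourSign e = sgn (col f (src G e)) (col f (tgt G e)) i j
  signedCount≡0 : sum (λ t → orientation t * colourSign (edge C t)) ≡ 0ℤ
  signedCount≡0 = trans (sym (push-walkChain f i j)) (null walkChain walkChain-isCycle i j i≢j)
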